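{- For every $k\ge 1$ we have $\langle B_k\rangle=\langle C_k\rangle$.
   Context: For finite sets $x,y$ of positive integers, $x\oplus y:=(x\setminus y)\cup(y\setminus x)$. For a family $X$ of subsets of $[n]=\{1,\dots,n\}$, the span $\langle X\rangle$ is the set of all sets of the form $x_1\oplus\cdots\oplus x_t$ with $t\ge 0$ and $x_i\in X$ (the empty symmetric difference being $\emptyset$); equivalently the $\mathbb{Z}_2$-linear span of the characteristic vectors. Define $B_1:=\emptyset$ and, for $k\ge 2$, $B_k:=B_{k-1}\cup\{\{i,2^{k-1}+i\}\mid 1\le i\le 2^{k-1}-1\}$. For an integer $t\ge1$, $t\cdot x:=\{ti\mid i\in x\}$ and $t\cdot X:=\{t\cdot x\mid x\in X\}$. Define $O_1:=C_1:=\emptyset$, and for $k\ge 2$: $O_k:=\{\{2i-1,2i+1\}\mid 1\le i\le 2^{k-1}-1\}$ and $C_k:=O_k\cup 2\cdot C_{k-1}$. -}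

module Defs where

open import Data.Nat using (ℕ; zero; suc; _+_; _*_; _∸_; _^_; _≟_)
open import Data.List using (List; []; _∷_; _++_; map; filter; foldr; upTo)
open import Data.List.Relation.Unary.All using (All)
open import Data.List.Membership.Propositional using (_∈_)
open import Data.List.Membership.DecPropositional _≟_ using (_∈?_)
open import Data.Product using (Σ; _×_)
open import Relation.Nullary.Decidable using (¬?)
open import Function.Bundles using (_⇔_)

-- A finite set of positive integers is represented by a list of its elements
-- (order and repetitions irrelevant); sets are compared extensionally.
FinSet : Set
FinSet = List ℕ

_≈ₛ_ : FinSet → FinSet → Set
x ≈ₛ y = ∀ n → (n ∈ x) ⇔ (n ∈ y)

_⊕_ : FinSet → FinSet → FinSet
x ⊕ y = filter (λ a → ¬? (a ∈? y)) x ++ filter (λ a → ¬? (a ∈? x)) y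

Family : Set
Family = List FinSet

_∈⟨_⟩ : FinSet → Family → Set
s ∈⟨ X ⟩ = Σ (List FinSet) λ xs → All (λ x → x ∈ X) xs × (foldr _⊕_ [] xs ≈ₛ s)

SpanEq : Family → Family → Set
SpanEq X Y = ∀ s → (s ∈⟨ X ⟩) ⇔ (s ∈⟨ Y ⟩)

range1 : ℕ → List ℕ
range1 m = map suc (upTo m)

_·ₛ_ : ℕ → FinSet → FinSet
t ·ₛ x = map (t *_) x

-- B_k (B 0 is an unused dummy value)
B : ℕ → Family
B zero = []
B (suc zero) = []
B (suc (suc k)) =
  B (suc k) ++ map (λ i → i ∷ (2 ^ suc k + i) ∷ []) (range1 (2 ^ suc k ∸ 1))

O : ℕ → Family
O zero = []
O (suc zero) = []
O (suc (suc k)) = map (λ i → (2 * i ∸ 1) ∷ (2 * i + 1) ∷ []) (range1 (2 ^ suc k ∸ 1))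

C : ℕ → Family
C zero = []
C (suc zero) = []
C (suc (suc k)) = O (suc (suc k)) ++ map (2 ·ₛ_) (C (suc k))

module Submission where

-- Both families consist of 2-element sets, i.e. they are edge sets of graphs on ℕ, and
-- {a, b} ∈ ⟨ Y ⟩ whenever a and b are connected in the graph Y (add up the edges of a path).
-- So it suffices to join the ends of every edge of one family by a path in the other, which
-- goes by induction on k.  In both B_k and C_k every odd number below 2^k is connected to 1:
-- in C_k along the path O_k, in B_k through the edge {a - 2^(k-1), a} when a > 2^(k-1).
-- This handles the edges of O_k and the new edges {i, 2^(k-1) + i} of B_k with i odd.  For
-- i even such an edge is the double of the edge {i/2, 2^(k-2) + i/2} of B_{k-1}, and
-- 2·C_{k-1} ⊆ C_k; conversely 2·B_{k-1} ⊆ B_k takes care of 2·C_{k-1}.  All other edges lie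
-- in B_{k-1} ⊆ B_k or C_{k-1} ⊆ C_k.

open import Defs
open import Data.Nat using (ℕ; zero; suc; _+_; _*_; _∸_; _^_; _≟_; _≡ᵇ_; _<_; _≤_; _≥_; _<?_; s≤s; z<s)
open import Data.Nat.Properties
  using ( ≡ᵇ⇒≡; n<1+n; <-trans; <-≤-trans; ≮⇒≥; <⇒≢; m≤m+n; m<n+m; +-comm; +-suc; +-identityʳ
        ; +-monoʳ-<; +-cancelˡ-<; *-suc; *-distribˡ-+; *-monoʳ-≤; *-monoʳ-<; *-cancelˡ-<
        ; *-cancelˡ-≡; m^n>0; m≤n⇒∃[o]m+o≡n )
open import Data.Bool using (Bool; true; false; _xor_)
open import Data.Bool.Properties using (xor-assoc; xor-comm; xor-same; xor-identityʳ)
open import Data.Empty using (⊥-elim)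
open import Data.List using (List; []; _∷_; _++_; foldr; filter)
open import Data.List.Membership.Propositional using (_∈_; _∉_)
open import Data.List.Membership.Propositional.Properties
  using (∈-filter⁺; ∈-filter⁻; ∈-++⁺ˡ; ∈-++⁺ʳ; ∈-++⁻; ∈-map⁺; ∈-map⁻; ∈-upTo⁺; ∈-upTo⁻)
open import Data.List.Membership.DecPropositional _≟_ using (_∈?_)
open import Data.List.Relation.Unary.All using (All; []; _∷_)
open import Data.List.Relation.Unary.All.Properties using (++⁺)
open import Data.Product using (∃; ∃₂; _×_; _,_; proj₁; proj₂)
open import Data.Sum using (_⊎_; inj₁; inj₂; [_,_])
open import Function.Base using (_∘_)
open import Function.Bundles using (mk⇔)
open import Level using (0ℓ)
open import Relation.Binary.Core using (Rel; _⇒_; _=[_]⇒_)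
open import Relation.Binary.Structures using (IsEquivalence)
open import Relation.Binary.Construct.Closure.Equivalence
  using (EqClosure; fold; return; gmap; map; symmetric)
open import Relation.Binary.Construct.Closure.ReflexiveTransitive using (ε; _◅◅_)
open import Relation.Binary.PropositionalEquality
  using (_≡_; _≢_; _≗_; refl; sym; trans; cong; cong₂; subst; module ≡-Reasoning)
open import Relation.Nullary using (does; proof; yes; no; Reflects; invert)
open import Relation.Nullary.Decidable using (¬?; dec-true; dec-false; does-⇔)

private
  variable
    a b j n : ℕ
    x y s : FinSet
    X Y : Family
    P Q : ℕ → Bool

χ : FinSet → ℕ → Bool
χ x n = does (n ∈? x)

χ-true⇒∈ : χ x n ≡ true → n ∈ x
χ-true⇒∈ {x} {n} e = invert (subst (Reflects (n ∈ x)) e (proof (n ∈? x)))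

≈ₛ⇒χ≗ : x ≈ₛ y → χ x ≗ χ y
≈ₛ⇒χ≗ {x} {y} x≈y n = does-⇔ (x≈y n) (n ∈? x) (n ∈? y)

χ≗⇒≈ₛ : χ x ≗ χ y → x ≈ₛ y
χ≗⇒≈ₛ {x} {y} e n = mk⇔ (λ n∈x → χ-true⇒∈ (trans (sym (e n)) (dec-true (n ∈? x) n∈x)))
                         (λ n∈y → χ-true⇒∈ (trans (e n) (dec-true (n ∈? y) n∈y)))

∈-⊕⁻ : n ∈ x ⊕ y → (n ∈ x × n ∉ y) ⊎ (n ∉ x × n ∈ y)
∈-⊕⁻ {x = x} {y} n∈x⊕y with ∈-++⁻ (filter (λ a → ¬? (a ∈? y)) x) n∈x⊕y
... | inj₁ p = inj₁ (∈-filter⁻ (λ a → ¬? (a ∈? y)) p)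
... | inj₂ p with ∈-filter⁻ (λ a → ¬? (a ∈? x)) p
...   | n∈y , n∉x = inj₂ (n∉x , n∈y)

χ-⊕ : ∀ x y → χ (x ⊕ y) ≗ λ n → χ x n xor χ y n
χ-⊕ x y n with n ∈? x | n ∈? y
... | yes n∈x | yes n∈y = dec-false (n ∈? x ⊕ y) ([ (λ p → proj₂ p n∈y) , (λ p → proj₁ p n∈x) ] ∘ ∈-⊕⁻)
... | yes n∈x | no  n∉y = dec-true (n ∈? x ⊕ y) (∈-++⁺ˡ (∈-filter⁺ (λ a → ¬? (a ∈? y)) n∈x n∉y))
... | no  n∉x | yes n∈y = dec-true (n ∈? x ⊕ y) (∈-++⁺ʳ _ (∈-filter⁺ (λ a → ¬? (a ∈? x)) n∈y n∉x))
... | no  n∉x | no  n∉y = dec-false (n ∈? x ⊕ y) ([ n∉x ∘ proj₁ , n∉y ∘ proj₂ ] ∘ ∈-⊕⁻)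

⨁ : List FinSet → FinSet
⨁ = foldr _⊕_ []

χ-⨁-++ : ∀ xs ys → χ (⨁ (xs ++ ys)) ≗ λ n → χ (⨁ xs) n xor χ (⨁ ys) n
χ-⨁-++ [] ys n = refl
χ-⨁-++ (x ∷ xs) ys n = begin
  χ (x ⊕ ⨁ (xs ++ ys)) n                   ≡⟨ χ-⊕ x _ n ⟩
  χ x n xor χ (⨁ (xs ++ ys)) n             ≡⟨ cong (χ x n xor_) (χ-⨁-++ xs ys n) ⟩
  χ x n xor (χ (⨁ xs) n xor χ (⨁ ys) n)   ≡⟨ xor-assoc (χ x n) _ _ ⟨
  (χ x n xor χ (⨁ xs) n) xor χ (⨁ ys) n   ≡⟨ cong (_xor χ (⨁ ys) n) (χ-⊕ x _ n) ⟨
  χ (x ⊕ ⨁ xs) n xor χ (⨁ ys) n           ∎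
  where open ≡-Reasoning

Spans : Family → (ℕ → Bool) → Set
Spans Y P = ∃ λ ys → All (_∈ Y) ys × χ (⨁ ys) ≗ P

spans-resp-≗ : P ≗ Q → Spans Y P → Spans Y Q
spans-resp-≗ P≗Q (ys , ys⊆Y , χys≗P) = ys , ys⊆Y , λ n → trans (χys≗P n) (P≗Q n)

spans-xor : Spans Y P → Spans Y Q → Spans Y (λ n → P n xor Q n)
spans-xor (xs , xs⊆Y , χxs≗P) (ys , ys⊆Y , χys≗Q) =
  xs ++ ys , ++⁺ xs⊆Y ys⊆Y , λ n → trans (χ-⨁-++ xs ys n) (cong₂ _xor_ (χxs≗P n) (χys≗Q n))

spans-generator : x ∈ Y → Spans Y (χ x)
spans-generator {x} x∈Y = x ∷ [] , x∈Y ∷ [] , λ n → trans (χ-⊕ x [] n) (xor-identityʳ (χ x n))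

spans-⨁ : (∀ {x} → x ∈ X → Spans Y (χ x)) → ∀ {xs} → All (_∈ X) xs → Spans Y (χ (⨁ xs))
spans-⨁ gen [] = [] , [] , λ n → refl
spans-⨁ gen (_∷_ {x} {xs} x∈X xs⊆X) =
  spans-resp-≗ (λ n → sym (χ-⊕ x (⨁ xs) n)) (spans-xor (gen x∈X) (spans-⨁ gen xs⊆X))

span-⊆ : (∀ {x} → x ∈ X → Spans Y (χ x)) → s ∈⟨ X ⟩ → s ∈⟨ Y ⟩
span-⊆ gen (xs , xs⊆X , ⨁xs≈s) with spans-⨁ gen xs⊆X
... | ys , ys⊆Y , χys≗χxs = ys , ys⊆Y , χ≗⇒≈ₛ (λ n → trans (χys≗χxs n) (≈ₛ⇒χ≗ ⨁xs≈s n))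

pair : ℕ → ℕ → FinSet
pair a b = a ∷ b ∷ []

-- χ computes through _≡ᵇ_, so the case split is on that rather than on _≟_.
χ-pair : a ≢ b → χ (pair a b) ≗ λ n → χ (a ∷ []) n xor χ (b ∷ []) n
χ-pair {a} {b} a≢b n with n ≡ᵇ a | n ≡ᵇ b | ≡ᵇ⇒≡ n a | ≡ᵇ⇒≡ n b
... | true  | true  | n≡a | n≡b = ⊥-elim (a≢b (trans (sym (n≡a _)) (n≡b _)))
... | true  | false | _   | _   = refl
... | false | _     | _   | _   = refl

_∼⟨_⟩_ : ℕ → Family → ℕ → Set
a ∼⟨ Y ⟩ b = Spans Y (λ n → χ (a ∷ []) n xor χ (b ∷ []) n)

∼-isEquivalence : IsEquivalence (_∼⟨ Y ⟩_)
∼-isEquivalence = record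
  { refl  = λ {a} → [] , [] , λ n → sym (xor-same (χ (a ∷ []) n))
  ; sym   = λ {a} {b} → spans-resp-≗ (λ n → xor-comm (χ (a ∷ []) n) _)
  ; trans = λ {a} {b} {c} a∼b b∼c → spans-resp-≗
      (λ n → xor-cancel-middle (χ (a ∷ []) n) (χ (b ∷ []) n) (χ (c ∷ []) n)) (spans-xor a∼b b∼c)
  }
  where
  xor-cancel-middle : ∀ p q r → (p xor q) xor (q xor r) ≡ p xor r
  xor-cancel-middle p q r = begin
    (p xor q) xor (q xor r)  ≡⟨ xor-assoc p q (q xor r) ⟩
    p xor (q xor (q xor r))  ≡⟨ cong (p xor_) (xor-assoc q q r) ⟨
    p xor ((q xor q) xor r)  ≡⟨ cong (λ t → p xor (t xor r)) (xor-same q) ⟩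
    p xor r                  ∎
    where open ≡-Reasoning

Edge : Family → Rel ℕ 0ℓ
Edge X a b = pair a b ∈ X

Connected : Family → Rel ℕ 0ℓ
Connected X = EqClosure (Edge X)

IsGraph : Family → Set
IsGraph X = ∀ {x} → x ∈ X → ∃₂ λ a b → a ≢ b × x ≡ pair a b

connected⇒∼ : IsGraph Y → Connected Y ⇒ _∼⟨ Y ⟩_
connected⇒∼ {Y} graph = fold ∼-isEquivalence edge⇒∼
  where
  edge⇒∼ : Edge Y ⇒ _∼⟨ Y ⟩_
  edge⇒∼ e with graph e
  ... | _ , _ , a≢b , refl = spans-resp-≗ (χ-pair a≢b) (spans-generator e)

edges-connected⇒span-⊆ : IsGraph X → IsGraph Y → Edge X ⇒ Connected Y → s ∈⟨ X ⟩ → s ∈⟨ Y ⟩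
edges-connected⇒span-⊆ {X} {Y} graphX graphY X⇒Y = span-⊆ generator
  where
  generator : x ∈ X → Spans Y (χ x)
  generator x∈X with graphX x∈X
  ... | _ , _ , a≢b , refl =
    spans-resp-≗ (λ n → sym (χ-pair a≢b n)) (connected⇒∼ graphY (X⇒Y x∈X))

m<n⇒1+2m<2n : ∀ {m n} → m < n → suc (2 * m) < 2 * n
m<n⇒1+2m<2n {m} {n} m<n = subst (_≤ 2 * n) (*-suc 2 m) (*-monoʳ-≤ 2 m<n)

1+2m<2n⇒m<n : ∀ {m n} → suc (2 * m) < 2 * n → m < n
1+2m<2n⇒m<n {m} {n} lt = *-cancelˡ-< 2 m n (<-trans (n<1+n (2 * m)) lt)

1+2[m+n]≡2m+1+2n : ∀ m n → suc (2 * (m + n)) ≡ 2 * m + suc (2 * n)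
1+2[m+n]≡2m+1+2n m n = trans (cong suc (*-distribˡ-+ 2 m n)) (sym (+-suc (2 * m) (2 * n)))

<2m⇒<m⊎≡m+ : ∀ {m n} → n < 2 * m → n < m ⊎ ∃ λ w → w < m × n ≡ m + w
<2m⇒<m⊎≡m+ {m} {n} n<2m with n <? m
... | yes n<m = inj₁ n<m
... | no n≮m with m≤n⇒∃[o]m+o≡n (≮⇒≥ n≮m)
...   | w , refl = inj₂ (w , +-cancelˡ-< m w m (subst (m + w <_) (cong (m +_) (+-identityʳ m)) n<2m) , refl)

even⊎odd : ∀ n → ∃ λ u → n ≡ 2 * u ⊎ n ≡ suc (2 * u)
even⊎odd zero = 0 , inj₁ refl
even⊎odd (suc n) with even⊎odd n
... | u , inj₁ refl = u , inj₂ refl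
... | u , inj₂ refl = suc u , inj₁ (sym (*-suc 2 u))

1+2n<1+2[1+n] : ∀ n → suc (2 * n) < suc (2 * suc n)
1+2n<1+2[1+n] n = s≤s (*-monoʳ-< 2 (n<1+n n))

m<n⇒n+m<2n : ∀ {m n} → m < n → n + m < 2 * n
m<n⇒n+m<2n {m} {n} m<n = subst (n + m <_) (cong (n +_) (sym (+-identityʳ n))) (+-monoʳ-< n m<n)

∈-range1⁺ : ∀ {p} → suc j < p → suc j ∈ range1 (p ∸ 1)
∈-range1⁺ {p = suc p} (s≤s j<p) = ∈-map⁺ suc (∈-upTo⁺ j<p)

∈-range1⁻ : ∀ {i p} → i ∈ range1 (p ∸ 1) → ∃ λ j → suc j < p × i ≡ suc j
∈-range1⁻ {p = suc p} i∈range with ∈-map⁻ suc i∈range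
... | j , j∈upTo , refl = j , s≤s (∈-upTo⁻ j∈upTo) , refl

B-mono : ∀ K → x ∈ B K → x ∈ B (suc K)
B-mono (suc (suc k)) = ∈-++⁺ˡ

B-new : ∀ K {i} → 0 < i → i < 2 ^ K → Edge (B (suc K)) i (2 ^ K + i)
B-new zero    {suc _} _ (s≤s ())
B-new (suc k) {suc j} _ i<2ᵏ⁺¹ =
  ∈-++⁺ʳ (B (suc k)) (∈-map⁺ (λ i → pair i (2 ^ suc k + i)) (∈-range1⁺ {p = 2 ^ suc k} i<2ᵏ⁺¹))

data BView (k : ℕ) : FinSet → Set where
  old : x ∈ B (suc k) → BView k x
  new : ∀ j → suc j < 2 ^ suc k → BView k (pair (suc j) (2 ^ suc k + suc j))

bView : ∀ k → x ∈ B (suc (suc k)) → BView k x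
bView k x∈B with ∈-++⁻ (B (suc k)) x∈B
... | inj₁ x∈old = old x∈old
... | inj₂ x∈new with ∈-map⁻ (λ i → pair i (2 ^ suc k + i)) x∈new
...   | i , i∈range , refl with ∈-range1⁻ {p = 2 ^ suc k} i∈range
...     | j , j<2ᵏ⁺¹ , refl = new j j<2ᵏ⁺¹

-- The induction hypothesis is passed to the helper as an argument, where the termination
-- checker can see that it is a call at a smaller level.
B-isGraph : ∀ K → IsGraph (B K)
B-isGraph (suc (suc k)) x∈B = from-view (B-isGraph (suc k)) (bView k x∈B)
  where
  from-view : IsGraph (B (suc k)) → BView k x → ∃₂ λ a b → a ≢ b × x ≡ pair a b
  from-view ih (old x∈old) = ih x∈old
  from-view _  (new j _)   = _ , _ , <⇒≢ (m<n+m (suc j) (m^n>0 2 (suc k))) , refl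

B-double : ∀ K → Edge (B K) =[ 2 *_ ]⇒ Edge (B (suc K))
B-double (suc (suc k)) e = from-view (B-double (suc k)) (bView k e)
  where
  from-view : Edge (B (suc k)) =[ 2 *_ ]⇒ Edge (B (suc (suc k))) →
              BView k (pair a b) → Edge (B (suc (suc (suc k)))) (2 * a) (2 * b)
  from-view ih (old e-old) = B-mono (suc (suc k)) (ih e-old)
  from-view _  (new j j<2ᵏ⁺¹) =
    subst (Edge (B (suc (suc (suc k)))) (2 * suc j)) (sym (*-distribˡ-+ 2 (2 ^ suc k) (suc j)))
      (B-new (suc (suc k)) z<s (*-monoʳ-< 2 j<2ᵏ⁺¹))

O-entry≡odd-pair : ∀ j → pair (2 * suc j ∸ 1) (2 * suc j + 1) ≡ pair (suc (2 * j)) (suc (2 * suc j))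
O-entry≡odd-pair j = cong₂ pair (cong (_∸ 1) (*-suc 2 j)) (+-comm (2 * suc j) 1)

C-odd : ∀ K u → suc (2 * suc u) < 2 ^ K → Edge (C K) (suc (2 * u)) (suc (2 * suc u))
C-odd zero u (s≤s ())
C-odd (suc zero) u (s≤s (s≤s ()))
C-odd (suc (suc k)) u lt =
  subst (_∈ C (suc (suc k))) (O-entry≡odd-pair u)
    (∈-++⁺ˡ (∈-map⁺ (λ i → pair (2 * i ∸ 1) (2 * i + 1)) (∈-range1⁺ {p = 2 ^ suc k} (1+2m<2n⇒m<n lt))))

C-double : ∀ K → x ∈ C K → 2 ·ₛ x ∈ C (suc K)
C-double (suc K) = ∈-++⁺ʳ (O (suc (suc K))) ∘ ∈-map⁺ (2 ·ₛ_)

-- The edge {2i - 1, 2i + 1} of O_{k+2} appears as {2j + 1, 2j + 3} with i = j + 1.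
data CView (k : ℕ) : FinSet → Set where
  odd    : ∀ j → suc (2 * suc j) < 2 ^ suc (suc k) → CView k (pair (suc (2 * j)) (suc (2 * suc j)))
  double : ∀ {y} → y ∈ C (suc k) → CView k (2 ·ₛ y)

cView : ∀ k → x ∈ C (suc (suc k)) → CView k x
cView k x∈C with ∈-++⁻ (O (suc (suc k))) x∈C
... | inj₂ x∈doubled with ∈-map⁻ (2 ·ₛ_) x∈doubled
...   | y , y∈C , refl = double y∈C
cView k x∈C | inj₁ x∈O with ∈-map⁻ (λ i → pair (2 * i ∸ 1) (2 * i + 1)) x∈O
...   | i , i∈range , refl with ∈-range1⁻ {p = 2 ^ suc k} i∈range
...     | j , j<2ᵏ⁺¹ , refl =
  subst (CView k) (sym (O-entry≡odd-pair j)) (odd j (m<n⇒1+2m<2n j<2ᵏ⁺¹))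

C-isGraph : ∀ K → IsGraph (C K)
C-isGraph (suc (suc k)) x∈C = from-view (C-isGraph (suc k)) (cView k x∈C)
  where
  from-view : IsGraph (C (suc k)) → CView k x → ∃₂ λ a b → a ≢ b × x ≡ pair a b
  from-view _  (odd j _) = _ , _ , <⇒≢ (1+2n<1+2[1+n] j) , refl
  from-view ih (double y∈C) with ih y∈C
  ... | a , b , a≢b , refl = 2 * a , 2 * b , a≢b ∘ *-cancelˡ-≡ a b 2 , refl

C-mono : ∀ K {x} → x ∈ C K → x ∈ C (suc K)
C-mono (suc (suc k)) x∈C = from-view (C-mono (suc k)) (cView k x∈C)
  where
  from-view : (∀ {y} → y ∈ C (suc k) → y ∈ C (suc (suc k))) → CView k x → x ∈ C (suc (suc (suc k)))
  from-view _  (odd j lt)   = C-odd (suc (suc (suc k))) j (<-≤-trans lt (m≤m+n _ _))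
  from-view ih (double y∈C) = C-double (suc (suc k)) (ih y∈C)

C-odd-connected : ∀ K u → suc (2 * u) < 2 ^ K → Connected (C K) 1 (suc (2 * u))
C-odd-connected K zero    _  = ε
C-odd-connected K (suc u) lt =
  C-odd-connected K u (<-trans (1+2n<1+2[1+n] u) lt) ◅◅ return (C-odd K u lt)

B-odd-connected : ∀ K u → suc (2 * u) < 2 ^ K → Connected (B K) 1 (suc (2 * u))
B-odd-connected zero          u       (s≤s ())
B-odd-connected (suc zero)    zero    _ = ε
B-odd-connected (suc zero)    (suc u) (s≤s (s≤s ()))
B-odd-connected (suc (suc k)) u       lt =
  from-split (B-odd-connected (suc k)) (<2m⇒<m⊎≡m+ (1+2m<2n⇒m<n {u} lt))
  where
  from-split : (∀ u → suc (2 * u) < 2 ^ suc k → Connected (B (suc k)) 1 (suc (2 * u))) →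
               ∀ {u} → u < 2 ^ k ⊎ (∃ λ w → w < 2 ^ k × u ≡ 2 ^ k + w) →
               Connected (B (suc (suc k))) 1 (suc (2 * u))
  from-split ih {u} (inj₁ u<2ᵏ) = map (B-mono (suc k)) (ih u (m<n⇒1+2m<2n u<2ᵏ))
  from-split ih (inj₂ (w , w<2ᵏ , refl)) =
    map (B-mono (suc k)) (ih w lt′) ◅◅
    subst (Connected (B (suc (suc k))) (suc (2 * w))) (sym (1+2[m+n]≡2m+1+2n (2 ^ k) w))
      (return (B-new (suc k) z<s lt′))
    where
    lt′ : suc (2 * w) < 2 ^ suc k
    lt′ = m<n⇒1+2m<2n w<2ᵏ

B⇒C : ∀ K → Edge (B K) ⇒ Connected (C K)
B⇒C (suc (suc k)) e = from-view (B⇒C (suc k)) (bView k e)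
  where
  from-view : Edge (B (suc k)) ⇒ Connected (C (suc k)) →
              BView k (pair a b) → Connected (C (suc (suc k))) a b
  from-view ih (old e-old) = map (C-mono (suc k)) (ih e-old)
  from-view ih (new j j<2ᵏ⁺¹) with even⊎odd (suc j)
  ... | u , inj₂ refl =
    symmetric _ (C-odd-connected (suc (suc k)) u (<-≤-trans j<2ᵏ⁺¹ (m≤m+n _ _))) ◅◅
    subst (Connected (C (suc (suc k))) 1) (1+2[m+n]≡2m+1+2n (2 ^ k) u)
      (C-odd-connected (suc (suc k)) (2 ^ k + u)
        (subst (_< 2 ^ suc (suc k)) (sym (1+2[m+n]≡2m+1+2n (2 ^ k) u)) (m<n⇒n+m<2n j<2ᵏ⁺¹)))
  ... | suc u , inj₁ refl =
    subst (Connected (C (suc (suc k))) (2 * suc u)) (*-distribˡ-+ 2 (2 ^ k) (suc u))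
      (gmap (2 *_) (C-double (suc k)) (ih (B-new k z<s (*-cancelˡ-< 2 (suc u) (2 ^ k) j<2ᵏ⁺¹))))

C⇒B : ∀ K → Edge (C K) ⇒ Connected (B K)
C⇒B (suc (suc k)) e = from-view (C⇒B (suc k)) (cView k e) refl
  where
  from-view : Edge (C (suc k)) ⇒ Connected (B (suc k)) →
              CView k x → x ≡ pair a b → Connected (B (suc (suc k))) a b
  from-view _ (odd j lt) refl =
    symmetric _ (B-odd-connected (suc (suc k)) j (<-trans (1+2n<1+2[1+n] j) lt)) ◅◅
    B-odd-connected (suc (suc k)) (suc j) lt
  from-view ih (double y∈C) x≡ab with C-isGraph (suc k) y∈C | x≡ab
  ... | _ , _ , _ , refl | refl = gmap (2 *_) (B-double (suc k)) (ih y∈C)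

lemma2p3 : ∀ (k : ℕ) → k ≥ 1 → SpanEq (B k) (C k)
lemma2p3 k _ s = mk⇔ (edges-connected⇒span-⊆ (B-isGraph k) (C-isGraph k) (B⇒C k))
                     (edges-connected⇒span-⊆ (C-isGraph k) (B-isGraph k) (C⇒B k))
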